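{- Let $\delta\in\{\mathrm{none},\mathrm{down},\mathrm{up},\mathrm{updown}\}^n$ be a permutree decoration. The set of inversion sets $\{B(T)\,:\, T\in\mathcal{PT}_n(\delta)\}$ is exactly the set of all subsets $E\subseteq \{(i,j)\in[n]^2\,:\,1\leq i<j\leq n\}$ such that, for all $1\leq i<j<k\leq n$: \begin{enumerate} \item $E$ is transitive, \item $E$ is cotransitive, \item if $\delta_j\in\{\mathrm{down},\mathrm{updown}\}$, $(i,j)\notin E$, and $(j,k)\in E$, then $(i,k)\notin E$, \item if $\delta_j\in\{\mathrm{up},\mathrm{updown}\}$, $(i,j)\in E$, and $(j,k)\notin E$, then $(i,k)\notin E$. \end{enumerate}
   Context: A permutree is a directed unrooted tree $T$ on vertices $v_1,\ldots,v_n$ such that each $v_i$ has one or two parents and one or two children; if $v_i$ has two parents (resp. children), all vertices in its left ancestor (resp. descendant) subtree have labels $<i$ and all in its right ancestor (resp. descendant) subtree have labels $>i$. We write $j\to i$ if $v_j$ is a descendant of $v_i$. The decoration $\delta(T)\in\{\mathrm{none},\mathrm{down},\mathrm{up},\mathrm{updown}\}^n$ has $\delta_i=\mathrm{none}$ if $v_i$ has one parent and one child, $\mathrm{down}$ if one parent and two children, $\mathrm{up}$ if two parents and one child, $\mathrm{updown}$ if two parents and two children (by convention $\delta_1=\delta_n=\mathrm{none}$). $\mathcal{PT}_n(\delta)$ is the set of permutrees with decoration $\delta$. The inversion set of $T$ is $B(T)=\{(i,j)\,:\,i<j \text{ and } j\to i\}$. A relation $R$ is transitive if $(x,y),(y,z)\in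 R$ implies $(x,z)\in R$, and cotransitive if $(x,y)\notin R$ and $(y,z)\notin R$ implies $(x,z)\notin R$. -}

module Defs where

open import Data.Nat using (ℕ; zero; suc)
open import Data.Fin using (Fin; toℕ; _<_)
open import Data.Bool using (Bool; true; false)
open import Data.List using (List; []; _∷_; _++_)
open import Data.List.Relation.Unary.Linked using (Linked)
open import Data.List.Relation.Unary.Unique.Propositional using (Unique)
open import Data.Product using (Σ; _×_; _,_)
open import Data.Sum using (_⊎_)
open import Relation.Nullary using (¬_)
open import Relation.Binary.PropositionalEquality using (_≡_; _≢_)
open import Relation.Binary.Construct.Closure.ReflexiveTransitive using (Star)

data Dec4 : Set where
  none down up updown : Dec4

IsDecoration : (n : ℕ) → (Fin n → Dec4) → Set
IsDecoration n δ = ∀ (i : Fin n) → (toℕ i ≡ 0 ⊎ suc (toℕ i) ≡ n) → δ i ≡ none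

-- two parent slots (up / updown) ?
twoUp : Dec4 → Bool
twoUp none   = false
twoUp down   = false
twoUp up     = true
twoUp updown = true

-- two child slots (down / updown) ?
twoDown : Dec4 → Bool
twoDown none   = false
twoDown down   = true
twoDown up     = false
twoDown updown = true

module _ {n : ℕ} (par : Fin n → Fin n → Bool) where
  -- par j i ≡ true : directed edge from child v_j to its parent v_i.
  Par : Fin n → Fin n → Set
  Par j i = par j i ≡ true

  Adj : Fin n → Fin n → Set
  Adj x y = Par x y ⊎ Par y x

  IsCycle : List (Fin n) → Set
  IsCycle [] = true ≡ false
  IsCycle (x ∷ []) = true ≡ false
  IsCycle (x ∷ y ∷ []) = true ≡ false
  IsCycle (x ∷ y ∷ z ∷ zs) =
    Unique (x ∷ y ∷ z ∷ zs) × Linked Adj ((x ∷ y ∷ z ∷ zs) ++ (x ∷ []))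

  IsTree : Set
  IsTree = (∀ x → ¬ Par x x)
         × (∀ x y → ¬ (Par x y × Par y x))
         × (∀ x y → Star Adj x y)
         × (∀ (cs : List (Fin n)) → ¬ IsCycle cs)

  -- w lies in the component of T ∖ {v_i} containing the neighbour p
  -- (the subtree of T hanging from v_i through the edge to p)
  AdjAvoid : Fin n → Fin n → Fin n → Set
  AdjAvoid i x y = Adj x y × x ≢ i × y ≢ i

  Comp : Fin n → Fin n → Fin n → Set
  Comp i p w = Star (AdjAvoid i) p w

  -- slot condition at vertex i for the neighbour relation N
  -- (N = parents or N = children of i):
  --  * one slot: at most one such neighbour;
  --  * two slots: the subtree through each such neighbour has all labels
  --    < i (left slot) or all labels > i (right slot), and at most one
  --    neighbour occupies each slot.
  SlotOK : Bool → Fin n → (Fin n → Set) → Set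
  SlotOK false i N = ∀ p q → N p → N q → p ≡ q
  SlotOK true  i N =
      (∀ p → N p → (∀ w → Comp i p w → w < i) ⊎ (∀ w → Comp i p w → i < w))
    × (∀ p q → N p → N q → p < i → q < i → p ≡ q)
    × (∀ p q → N p → N q → i < p → i < q → p ≡ q)

-- Permutrees on v_1..v_n with decoration δ (dangling parent/child edges
-- are not vertices; a vertex may thus have fewer actual neighbours than
-- its slots).
record Permutree (n : ℕ) (δ : Fin n → Dec4) : Set where
  field
    par     : Fin n → Fin n → Bool
    tree    : IsTree par
    parents  : ∀ i → SlotOK par (twoUp (δ i)) i (λ p → Par par i p)
    children : ∀ i → SlotOK par (twoDown (δ i)) i (λ c → Par par c i)

open Permutree public

-- j → i : v_j is a descendant of v_i (directed path from j up to i)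
Desc : ∀ {n δ} → Permutree n δ → Fin n → Fin n → Set
Desc T j i = Star (Par (par T)) j i

InvSet : ∀ {n δ} → Permutree n δ → Fin n → Fin n → Set
InvSet T i j = i < j × Desc T j i

Conditions : ∀ {n} → (Fin n → Dec4) → (Fin n → Fin n → Set) → Set
Conditions {n} δ E = ∀ (i j k : Fin n) → i < j → j < k →
    (E i j → E j k → E i k)
  × (¬ E i j → ¬ E j k → ¬ E i k)
  × ((δ j ≡ down ⊎ δ j ≡ updown) → ¬ E i j → E j k → ¬ E i k)
  × ((δ j ≡ up ⊎ δ j ≡ updown) → E i j → ¬ E j k → ¬ E i k)

module Submission where

-- If v_j lies strictly between the ends of an edge u → v of a permutree, then v_j is a descendant
-- of u or an ancestor of v: otherwise the simple path from v to v_j turns at a vertex with two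
-- children (or two parents) whose subtrees lie on both sides of j, against the slot condition there.
-- Along a path k → i this gives transitivity and cotransitivity of the inversion set, and the slot
-- condition at a down (up) vertex j forbids an edge jumping over j inside its child (parent)
-- subtrees, which gives conditions 3 and 4.
--
-- Conversely, under the conditions  a ≺ b :⇔ (b < a ∧ (b,a) ∈ E) ∨ (a < b ∧ (a,b) ∉ E)  is a strict
-- total order. Strengthening it by constraints on the down and up vertices between a and b gives the
-- descendant relation a ↝ b, and the permutree is the Hasse diagram of ↝. No vertex between the ends
-- of a covering pair lies ≺-between them, which yields the slot conditions and acyclicity; every
-- a ↝ b is realised by a path and every path ascends in ≺, so the inversion set is exactly E.

open import Defs
open import Data.Nat using (ℕ; suc; s≤s⁻¹)
import Data.Nat.Properties as ℕ
open import Data.Fin as Fin using (Fin; _<_; toℕ; inject₁)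
open import Data.Fin.Induction using (<-weakInduction; spo-wellFounded; spo-noetherian)
open import Data.Fin.Properties using (_≟_; <-cmp; <-trans; <-irrefl; <-asym; <⇒≢; _<?_; all?; any?; toℕ-inject₁)
open import Data.Bool using (Bool; true; false)
import Data.Bool.Properties as Bool
open import Data.List using (List; []; _∷_; _++_; allFin; length)
import Data.List.Properties as List
open import Data.List.Relation.Unary.Linked as Linked using (Linked; []; [-]; _∷_)
open import Data.List.Relation.Unary.All as All using (All; []; _∷_; lookup)
open import Data.List.Relation.Unary.All.Properties using (¬Any⇒All¬; All¬⇒¬Any)
open import Data.List.Relation.Unary.AllPairs as AllPairs using ([]; _∷_)
open import Data.List.Relation.Unary.Unique.Propositional using (Unique)
open import Data.List.Relation.Unary.Any using (here; there)
open import Data.List.Membership.Propositional using (_∈_; _∉_)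
open import Data.List.Membership.Propositional.Properties using (∈-allFin; ∈-filter⁺; ∈-filter⁻; ∈-∃++)
import Data.List.Membership.DecPropositional as DecMembership
open import Data.List.Relation.Binary.Permutation.Propositional using (_↭_; ↭-trans; ↭-reflexive; ↭⇒↭ₛ)
open import Data.List.Relation.Binary.Permutation.Propositional.Properties
  using (All-resp-↭; ↭-length) renaming (++-comm to ↭-++-comm)
open import Data.List.Relation.Binary.Permutation.Setoid.Properties using (Unique-resp-↭)
open import Data.Product using (Σ; ∃; _×_; _,_; proj₁; proj₂)
open import Data.Sum using (_⊎_; inj₁; inj₂; [_,_]′)
import Data.Sum
open import Data.Empty using (⊥; ⊥-elim)
open import Function using (_∘′_; id; flip; case_of_)
open import Function.Bundles using (_⇔_; mk⇔)
open import Induction.WellFounded using (Acc; acc)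
open import Relation.Nullary using (¬_; ¬?; Dec; yes; no)
open import Relation.Nullary.Decidable using (_×-dec_; _⊎-dec_; _→-dec_; isYes)
open import Relation.Unary using (Decidable)
open import Relation.Binary using (tri<; tri≈; tri>; DecidableEquality; IsStrictPartialOrder)
open import Relation.Binary.PropositionalEquality as ≡ using (_≡_; _≢_; refl; sym; trans; subst; cong)
open import Relation.Binary.Construct.Closure.ReflexiveTransitive as Star using (Star; ε; _◅_; _◅◅_)

≢⇒<⊎> : ∀ {n} {a b : Fin n} → a ≢ b → a < b ⊎ b < a
≢⇒<⊎> {a = a} {b} a≢b with <-cmp a b
... | tri< a<b _ _ = inj₁ a<b
... | tri≈ _ a≡b _ = ⊥-elim (a≢b a≡b)
... | tri> _ _ b<a = inj₂ b<a

Between : ∀ {n} → Fin n → Fin n → Fin n → Set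
Between j a b = (a < j × j < b) ⊎ (b < j × j < a)

module _ {n : ℕ} where

  between-sym : {j a b : Fin n} → Between j a b → Between j b a
  between-sym (inj₁ p) = inj₂ p
  between-sym (inj₂ p) = inj₁ p

  between⇒≢ˡ : {j a b : Fin n} → Between j a b → j ≢ a
  between⇒≢ˡ (inj₁ (a<j , _)) refl = <-irrefl refl a<j
  between⇒≢ˡ (inj₂ (_ , j<a)) refl = <-irrefl refl j<a

  between⇒≢ʳ : {j a b : Fin n} → Between j a b → j ≢ b
  between⇒≢ʳ = between⇒≢ˡ ∘′ between-sym

  ¬between-self : {j a : Fin n} → ¬ Between j a a
  ¬between-self (inj₁ (a<j , j<a)) = <-asym a<j j<a
  ¬between-self (inj₂ (a<j , j<a)) = <-asym a<j j<a

  between? : (j a b : Fin n) → Dec (Between j a b)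
  between? j a b = ((a <? j) ×-dec (j <? b)) ⊎-dec ((b <? j) ×-dec (j <? a))

  between-step : {j a b c : Fin n} → Between j a b → ¬ Between j a c → j ≢ c → Between j c b
  between-step {j} {c = c} (inj₁ (a<j , j<b)) ¬jac j≢c with ≢⇒<⊎> j≢c
  ... | inj₁ j<c = ⊥-elim (¬jac (inj₁ (a<j , j<c)))
  ... | inj₂ c<j = inj₁ (c<j , j<b)
  between-step {j} {c = c} (inj₂ (b<j , j<a)) ¬jac j≢c with ≢⇒<⊎> j≢c
  ... | inj₁ j<c = inj₂ (b<j , j<c)
  ... | inj₂ c<j = ⊥-elim (¬jac (inj₂ (c<j , j<a)))

  between-split : {a b k i : Fin n} → a < k → k < b → k ≢ i → Between k a i ⊎ Between k b i
  between-split a<k k<b k≢i with ≢⇒<⊎> k≢i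
  ... | inj₁ k<i = inj₁ (inj₁ (a<k , k<i))
  ... | inj₂ i<k = inj₂ (inj₂ (i<k , k<b))

  between⇒one-above : {j a b q : Fin n} → q < j → Between j a b → q < a ⊎ q < b
  between⇒one-above q<j (inj₁ (_ , j<b)) = inj₂ (<-trans q<j j<b)
  between⇒one-above q<j (inj₂ (_ , j<a)) = inj₁ (<-trans q<j j<a)

  between⇒one-below : {j a b q : Fin n} → j < q → Between j a b → a < q ⊎ b < q
  between⇒one-below j<q (inj₁ (a<j , _)) = inj₁ (<-trans a<j j<q)
  between⇒one-below j<q (inj₂ (b<j , _)) = inj₂ (<-trans b<j j<q)

  between-left : {j a b : Fin n} → Between j a b → j < a → b < j
  between-left (inj₁ (a<j , _)) j<a = ⊥-elim (<-asym a<j j<a)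
  between-left (inj₂ (b<j , _)) _   = b<j

  between-right : {j a b : Fin n} → Between j a b → b < j → j < a
  between-right (inj₁ (_ , j<b)) b<j = ⊥-elim (<-asym j<b b<j)
  between-right (inj₂ (_ , j<a)) _   = j<a

  between-below : {j a b : Fin n} → a < j → ¬ b < j → b ≢ j → Between j a b
  between-below {j} {b = b} a<j b≮j b≢j with ≢⇒<⊎> b≢j
  ... | inj₁ b<j = ⊥-elim (b≮j b<j)
  ... | inj₂ j<b = inj₁ (a<j , j<b)

  between-above : {j a b : Fin n} → j < a → ¬ j < b → b ≢ j → Between j a b
  between-above {j} {b = b} j<a j≮b b≢j with ≢⇒<⊎> b≢j
  ... | inj₁ b<j = inj₂ (b<j , j<a)
  ... | inj₂ j<b = ⊥-elim (j≮b j<b)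

  between-unique-below : {i a b : Fin n} → (a ≢ b → Between i a b) → a < i → b < i → a ≡ b
  between-unique-below {a = a} {b} split a<i b<i with a ≟ b
  ... | yes a≡b = a≡b
  ... | no a≢b with split a≢b
  ...   | inj₁ (_ , i<b) = ⊥-elim (<-asym b<i i<b)
  ...   | inj₂ (_ , i<a) = ⊥-elim (<-asym a<i i<a)

  between-unique-above : {i a b : Fin n} → (a ≢ b → Between i a b) → i < a → i < b → a ≡ b
  between-unique-above {a = a} {b} split i<a i<b with a ≟ b
  ... | yes a≡b = a≡b
  ... | no a≢b with split a≢b
  ...   | inj₁ (a<i , _) = ⊥-elim (<-asym a<i i<a)
  ...   | inj₂ (b<i , _) = ⊥-elim (<-asym b<i i<b)

consecutive⇒connected : ∀ {n} {R : Fin n → Fin n → Set} → (∀ {x y} → R x y → R y x) →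
  (∀ a b → toℕ b ≡ suc (toℕ a) → Star R a b) → ∀ x y → Star R x y
consecutive⇒connected {suc m} {R} R-sym consecutive x y = to-zero x ◅◅ Star.reverse R-sym (to-zero y)
  where
    to-zero : ∀ x → Star R x Fin.zero
    to-zero = <-weakInduction (λ x → Star R x Fin.zero) ε λ i i→0 →
      Star.reverse R-sym (consecutive (inject₁ i) (Fin.suc i) (cong suc (sym (toℕ-inject₁ i)))) ◅◅ i→0

twoDown⇒down⊎updown : ∀ {d} → twoDown d ≡ true → d ≡ down ⊎ d ≡ updown
twoDown⇒down⊎updown {down}   _ = inj₁ refl
twoDown⇒down⊎updown {updown} _ = inj₂ refl

down⊎updown⇒twoDown : ∀ {d} → d ≡ down ⊎ d ≡ updown → twoDown d ≡ true
down⊎updown⇒twoDown (inj₁ refl) = refl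
down⊎updown⇒twoDown (inj₂ refl) = refl

twoUp⇒up⊎updown : ∀ {d} → twoUp d ≡ true → d ≡ up ⊎ d ≡ updown
twoUp⇒up⊎updown {up}     _ = inj₁ refl
twoUp⇒up⊎updown {updown} _ = inj₂ refl

up⊎updown⇒twoUp : ∀ {d} → d ≡ up ⊎ d ≡ updown → twoUp d ≡ true
up⊎updown⇒twoUp (inj₁ refl) = refl
up⊎updown⇒twoUp (inj₂ refl) = refl

module _ {A : Set} where

  lastOf : A → List A → A
  lastOf a []       = a
  lastOf a (x ∷ xs) = lastOf x xs

  lastOf-∈ : (a : A) (xs : List A) → lastOf a xs ∈ a ∷ xs
  lastOf-∈ a []       = here refl
  lastOf-∈ a (x ∷ xs) = there (lastOf-∈ x xs)

  SimplePath : (A → A → Set) → A → A → Set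
  SimplePath R a b = Σ (List A) λ xs → Linked R (a ∷ xs) × Unique (a ∷ xs) × lastOf a xs ≡ b

  Linked⇒Star : {R : A → A → Set} {a w : A} {xs : List A} →
    Linked R (a ∷ xs) → w ∈ a ∷ xs → Star R a w
  Linked⇒Star L             (here refl) = ε
  Linked⇒Star {xs = _ ∷ _} (r ∷ L) (there w∈) = r ◅ Linked⇒Star L w∈

  Linked-restrict : {R : A → A → Set} {P : A → Set} {xs : List A} → Linked R xs → All P xs →
    Linked (λ x y → R x y × P x × P y) xs
  Linked-restrict []      []             = []
  Linked-restrict [-]     (_ ∷ [])       = [-]
  Linked-restrict (r ∷ L) (p ∷ ps@(q ∷ _)) = (r , p , q) ∷ Linked-restrict L ps

  Linked-∷ʳ : {R : A → A → Set} {u v : A} (us : List A) → Linked R (u ∷ us) → R (lastOf u us) v →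
    Linked R ((u ∷ us) ++ v ∷ [])
  Linked-∷ʳ []       [-]     r = r ∷ [-]
  Linked-∷ʳ (_ ∷ us) (r ∷ L) s = r ∷ Linked-∷ʳ us L s

  Linked-∷ʳ⁻ : {R : A → A → Set} {u v : A} (us : List A) → Linked R ((u ∷ us) ++ v ∷ []) →
    Linked R (u ∷ us) × R (lastOf u us) v
  Linked-∷ʳ⁻ []       (r ∷ [-]) = [-] , r
  Linked-∷ʳ⁻ (_ ∷ us) (r ∷ L)   with Linked-∷ʳ⁻ us L
  ... | L′ , s = r ∷ L′ , s

  Linked-++⁻ : {R : A → A → Set} (as : List A) {y : A} {bs : List A} →
    Linked R (as ++ y ∷ bs) → Linked R (as ++ y ∷ []) × Linked R (y ∷ bs)
  Linked-++⁻ []              L       = [-] , L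
  Linked-++⁻ (_ ∷ [])        (r ∷ L) = r ∷ [-] , L
  Linked-++⁻ (_ ∷ as@(_ ∷ _)) (r ∷ L) with Linked-++⁻ as L
  ... | L₁ , L₂ = r ∷ L₁ , L₂

  Linked-++⁺ : {R : A → A → Set} (as : List A) {y : A} {bs : List A} →
    Linked R (as ++ y ∷ []) → Linked R (y ∷ bs) → Linked R (as ++ y ∷ bs)
  Linked-++⁺ []               _         L₂ = L₂
  Linked-++⁺ (_ ∷ [])         (r ∷ _)   L₂ = r ∷ L₂
  Linked-++⁺ (_ ∷ as@(_ ∷ _)) (r ∷ L₁) L₂ = r ∷ Linked-++⁺ as L₁ L₂

  Linked-rotate : {R : A → A → Set} {h m : A} {hs : List A} (pre post : List A) → h ∷ hs ≡ pre ++ m ∷ post →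
    Linked R ((h ∷ hs) ++ h ∷ []) → Linked R (m ∷ (post ++ pre) ++ m ∷ [])
  Linked-rotate [] post refl L rewrite List.++-identityʳ post = L
  Linked-rotate {R} {m = m} (p ∷ pre) post refl L
    with Linked-++⁻ (p ∷ pre) (subst (Linked R) (List.++-assoc (p ∷ pre) (m ∷ post) (p ∷ [])) L)
  ... | L₁ , L₂ =
    subst (Linked R) (sym (List.++-assoc (m ∷ post) (p ∷ pre) (m ∷ [])))
      (Linked-++⁺ (m ∷ post) L₂ L₁)

  Star-crossing : {R : A → A → Set} {P : A → Set} {a b : A} → (∀ x → Dec (P x)) →
    Star R a b → P a → ¬ P b → ∃ λ x → ∃ λ y → Star R a x × R x y × P x × ¬ P y
  Star-crossing P? ε pa ¬pb = ⊥-elim (¬pb pa)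
  Star-crossing P? (_◅_ {j = a′} r rs) pa ¬pb with P? a′
  ... | no ¬pa′ = _ , a′ , ε , r , pa , ¬pa′
  ... | yes pa′ with Star-crossing P? rs pa′ ¬pb
  ...   | x , y , a′x , xy , px , ¬py = x , y , r ◅ a′x , xy , px , ¬py

  suffixFrom : {a : A} {xs : List A} → a ∈ xs → List A
  suffixFrom {xs = _ ∷ ys} (here _)   = ys
  suffixFrom {xs = _ ∷ _}  (there a∈) = suffixFrom a∈

  All-suffixFrom : {P : A → Set} {a : A} {xs : List A} (a∈ : a ∈ xs) → All P xs → All P (a ∷ suffixFrom a∈)
  All-suffixFrom (here refl) ps       = ps
  All-suffixFrom (there a∈)  (_ ∷ ps) = All-suffixFrom a∈ ps

  Unique-suffixFrom : {a : A} {xs : List A} (a∈ : a ∈ xs) → Unique xs → Unique (a ∷ suffixFrom a∈)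
  Unique-suffixFrom (here refl) U       = U
  Unique-suffixFrom (there a∈)  (_ ∷ U) = Unique-suffixFrom a∈ U

  Linked-suffixFrom : {R : A → A → Set} {a : A} {xs : List A} (a∈ : a ∈ xs) → Linked R xs →
    Linked R (a ∷ suffixFrom a∈)
  Linked-suffixFrom (here refl) L = L
  Linked-suffixFrom (there a∈)  L = Linked-suffixFrom a∈ (Linked.tail L)

  lastOf-suffixFrom : {a : A} (y : A) {xs : List A} (a∈ : a ∈ xs) → lastOf a (suffixFrom a∈) ≡ lastOf y xs
  lastOf-suffixFrom y (here refl)          = refl
  lastOf-suffixFrom y {x ∷ _} (there a∈) = lastOf-suffixFrom x a∈

  SimplePath-suffix : {R : A → A → Set} {a y : A} {xs : List A} → a ∈ y ∷ xs →
    Linked R (y ∷ xs) → Unique (y ∷ xs) → SimplePath R a (lastOf y xs)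
  SimplePath-suffix {y = y} a∈ L U =
    suffixFrom a∈ , Linked-suffixFrom a∈ L , Unique-suffixFrom a∈ U , lastOf-suffixFrom y a∈

  module _ (_≟A_ : DecidableEquality A) where
    open DecMembership _≟A_ using (_∈?_)

    Star⇒SimplePath : {R : A → A → Set} {a b : A} → Star R a b → SimplePath R a b
    Star⇒SimplePath ε = [] , [-] , [] ∷ [] , refl
    Star⇒SimplePath {a = a} (_◅_ {j = a′} r rs) with Star⇒SimplePath rs
    ... | xs , L , U , last≡ with a ∈? a′ ∷ xs
    ...   | yes a∈ with SimplePath-suffix a∈ L U
    ...     | ys , L′ , U′ , last≡′ = ys , L′ , U′ , trans last≡′ last≡
    Star⇒SimplePath {a = a} (_◅_ {j = a′} r rs) | xs , L , U , last≡ | no a∉ =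
      a′ ∷ xs , r ∷ L , ¬Any⇒All¬ (a′ ∷ xs) a∉ ∷ U , last≡

module _ {n : ℕ} {R : Fin n → Fin n → Set} where

  Star-between : ∀ {a b j} → Star R a b → Between j a b →
    (Star R a j × Star R j b) ⊎ ∃ λ u → ∃ λ v → Star R a u × R u v × Star R v b × Between j u v
  Star-between ε bt = ⊥-elim (¬between-self bt)
  Star-between {a} {j = j} (_◅_ {j = a′} r rs) bt with between? j a a′
  ... | yes bt′ = inj₂ (a , a′ , ε , r , rs , bt′)
  ... | no ¬bt′ with j ≟ a′
  ...   | yes refl = inj₁ (r ◅ ε , rs)
  ...   | no j≢a′ with Star-between rs (between-step bt ¬bt′ j≢a′)
  ...     | inj₁ (a′j , jb) = inj₁ (r ◅ a′j , jb)
  ...     | inj₂ (u , v , a′u , uv , vb , bt″) = inj₂ (u , v , r ◅ a′u , uv , vb , bt″)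

OneSided : ∀ {n} → (Fin n → Fin n → Bool) → Fin n → Fin n → Set
OneSided par i p = (∀ w → Comp par i p w → w < i) ⊎ (∀ w → Comp par i p w → i < w)

module _ {n : ℕ} (par : Fin n → Fin n → Bool) where

  Adj-sym : ∀ {x y} → Adj par x y → Adj par y x
  Adj-sym (inj₁ p) = inj₂ p
  Adj-sym (inj₂ p) = inj₁ p

  AdjAvoid-sym : ∀ {i x y} → AdjAvoid par i x y → AdjAvoid par i y x
  AdjAvoid-sym (xy , x≢i , y≢i) = Adj-sym xy , y≢i , x≢i

  Comp-sym : ∀ {i x y} → Comp par i x y → Comp par i y x
  Comp-sym = Star.reverse AdjAvoid-sym

  Comp-start≢ : ∀ {i a b} → Comp par i a b → b ≢ i → a ≢ i
  Comp-start≢ ε                  b≢i = b≢i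
  Comp-start≢ ((_ , a≢i , _) ◅ _) _   = a≢i

  Linked⇒Comp : ∀ {i a w} {xs : List (Fin n)} → Linked (Adj par) (a ∷ xs) → All (i ≢_) (a ∷ xs) →
    w ∈ a ∷ xs → Comp par i a w
  Linked⇒Comp L i∉ w∈ =
    Star.map (λ (xy , i≢x , i≢y) → xy , i≢x ∘′ sym , i≢y ∘′ sym)
      (Linked⇒Star (Linked-restrict L i∉) w∈)

  Star-last-visit : {R : Fin n → Fin n → Set} → (∀ {a b} → R a b → Adj par a b) → ∀ {j a u} →
    Star R a u → u ≢ j → Comp par j a u ⊎ ∃ λ p → R j p × Comp par j p u
  Star-last-visit R⇒Adj ε u≢j = inj₁ ε
  Star-last-visit R⇒Adj {j} {a} (_◅_ {j = a′} r rs) u≢j with Star-last-visit R⇒Adj rs u≢j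
  ... | inj₂ last = inj₂ last
  ... | inj₁ a′u with a ≟ j
  ...   | yes refl = inj₂ (a′ , r , a′u)
  ...   | no a≢j   = inj₁ ((R⇒Adj r , a≢j , Comp-start≢ a′u u≢j) ◅ a′u)

  ancestor∈parent-component : ∀ {j u} → Star (Par par) j u → u ≢ j →
    ∃ λ p → Par par j p × Comp par j p u
  ancestor∈parent-component ju u≢j with Star-last-visit inj₁ ju u≢j
  ... | inj₁ ju′ = ⊥-elim (Comp-start≢ ju′ u≢j refl)
  ... | inj₂ last = last

  descendant∈child-component : ∀ {j v} → Star (Par par) v j → v ≢ j →
    ∃ λ c → Par par c j × Comp par j c v
  descendant∈child-component vj v≢j with Star-last-visit inj₂ (Star.reverse id vj) v≢j
  ... | inj₁ jv = ⊥-elim (Comp-start≢ jv v≢j refl)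
  ... | inj₂ last = last

  Linked-avoid⇒All≢ : ∀ {i a b} {xs : List (Fin n)} → Linked (AdjAvoid par i) (a ∷ b ∷ xs) →
    All (i ≢_) (a ∷ b ∷ xs)
  Linked-avoid⇒All≢ {xs = []}    ((_ , a≢i , b≢i) ∷ [-]) = (a≢i ∘′ sym) ∷ (b≢i ∘′ sym) ∷ []
  Linked-avoid⇒All≢ {xs = _ ∷ _} ((_ , a≢i , _) ∷ L)     = (a≢i ∘′ sym) ∷ Linked-avoid⇒All≢ L

  NoJumpOver : Fin n → Fin n → Set
  NoJumpOver i s = ∀ {x y} → Par par x y → Between i x y → Comp par i s x → Comp par i s y → ⊥

  Comp-no-crossing : ∀ {i s} → NoJumpOver i s → (S : Fin n → Set) → (∀ x → Dec (S x)) →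
    (∀ {u v} → S u → ¬ S v → v ≢ i → Between i u v) → S s → ∀ {w} → Comp par i s w → S w
  Comp-no-crossing {i} {s} no-jump S S? split ss {w} sw with S? w
  ... | yes sw′ = sw′
  ... | no ¬sw′ with Star-crossing S? sw ss ¬sw′
  ...   | u , v , su , u—v@(uv , _ , v≢i) , Su , ¬Sv =
    ⊥-elim (no-adjacent-jump uv (split Su ¬Sv v≢i) su (su ◅◅ u—v ◅ ε))
    where
      no-adjacent-jump : ∀ {x y} → Adj par x y → Between i x y → Comp par i s x → Comp par i s y → ⊥
      no-adjacent-jump (inj₁ x⟶y) bt sx sy = no-jump x⟶y bt sx sy
      no-adjacent-jump (inj₂ y⟶x) bt sx sy = no-jump y⟶x (between-sym bt) sy sx

  NoJumpOver⇒OneSided : ∀ {i s} → s ≢ i → NoJumpOver i s → OneSided par i s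
  NoJumpOver⇒OneSided {i} s≢i no-jump with ≢⇒<⊎> s≢i
  ... | inj₁ s<i = inj₁ λ w → Comp-no-crossing no-jump (_< i) (_<? i) between-below s<i
  ... | inj₂ i<s = inj₂ λ w → Comp-no-crossing no-jump (i <_) (i <?_) between-above i<s

  OneSided-¬between : ∀ {j c u v} → OneSided par j c → Between j u v →
    Comp par j c u → Comp par j c v → ⊥
  OneSided-¬between (inj₁ below) (inj₁ (_ , j<v)) _  cv = <-asym j<v (below _ cv)
  OneSided-¬between (inj₁ below) (inj₂ (_ , j<u)) cu _  = <-asym j<u (below _ cu)
  OneSided-¬between (inj₂ above) (inj₁ (u<j , _)) cu _  = <-asym u<j (above _ cu)
  OneSided-¬between (inj₂ above) (inj₂ (v<j , _)) _  cv = <-asym v<j (above _ cv)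

module _ {A : Set} (_≟A_ : DecidableEquality A) {_≺_ : A → A → Set}
         (≺-trans : ∀ {a b c} → a ≺ b → b ≺ c → a ≺ c)
         (≺-total : ∀ {a b} → a ≢ b → a ≺ b ⊎ b ≺ a) where

  maximum : (x : A) (xs : List A) → ∃ λ m → m ∈ x ∷ xs × All (λ y → y ≡ m ⊎ y ≺ m) (x ∷ xs)
  maximum x [] = x , here refl , inj₁ refl ∷ []
  maximum x (y ∷ ys) with maximum y ys
  ... | m , m∈ , below with x ≟A m
  ...   | yes x≡m = m , there m∈ , inj₁ x≡m ∷ below
  ...   | no x≢m with ≺-total x≢m
  ...     | inj₁ x≺m = m , there m∈ , inj₂ x≺m ∷ below
  ...     | inj₂ m≺x = x , here refl , inj₁ refl ∷ All.map (λ y≼m → inj₂ (≼-≺-trans y≼m m≺x)) below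
    where
      ≼-≺-trans : ∀ {a b c} → a ≡ b ⊎ a ≺ b → b ≺ c → a ≺ c
      ≼-≺-trans (inj₁ refl) b≺c = b≺c
      ≼-≺-trans (inj₂ a≺b)  b≺c = ≺-trans a≺b b≺c

  maximum-∈ : ∀ {x xs} → x ∈ xs → ∃ λ m → m ∈ xs × All (λ y → y ≡ m ⊎ y ≺ m) xs
  maximum-∈ {xs = y ∷ ys} _ = maximum y ys

module _ {n : ℕ} {_≺_ : Fin n → Fin n → Set}
         (≺-trans : ∀ {a b c} → a ≺ b → b ≺ c → a ≺ c)
         (≺-total : ∀ {a b} → a ≢ b → a ≺ b ⊎ b ≺ a) where

  maximal : {Q : Fin n → Set} → Decidable Q → ∀ {x} → Q x →
    ∃ λ m → Q m × (∀ {y} → Q y → y ≡ m ⊎ y ≺ m)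
  maximal Q? {x} qx with maximum-∈ _≟_ ≺-trans ≺-total (∈-filter⁺ Q? (∈-allFin x) qx)
  ... | m , m∈ , below =
    m , proj₂ (∈-filter⁻ Q? {xs = allFin n} m∈) , λ {y} qy → lookup below (∈-filter⁺ Q? (∈-allFin y) qy)

module InversionsOfPermutree {n : ℕ} {δ : Fin n → Dec4} (T : Permutree n δ) where

  private
    _⟶_ : Fin n → Fin n → Set
    _⟶_ = Par (par T)

    _—_ : Fin n → Fin n → Set
    _—_ = Adj (par T)

    irreflexive : ∀ x → ¬ x ⟶ x
    irreflexive = proj₁ (tree T)

    connected : ∀ x y → Star _—_ x y
    connected = proj₁ (proj₂ (proj₂ (tree T)))

    open DecMembership (_≟_ {n}) using (_∈?_)

  module Climb (Q : Fin n → Fin n → Set) (Q⇒— : ∀ {a b} → Q a b → a — b)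
               (—⇒Q : ∀ {a b} → a — b → Q a b ⊎ Q b a) (twoSlots : Fin n → Bool)
               (slots : ∀ i → SlotOK (par T) (twoSlots i) i (λ c → Q c i))
               {x y j : Fin n} (j-between : Between j x y) where

    private
      ¬above : ∀ {q p w} → (∀ w → Comp (par T) q p w → w < q) → w ≡ q ⊎ Comp (par T) q p w → ¬ q < w
      ¬above below (inj₁ refl) q<q = <-irrefl refl q<q
      ¬above below (inj₂ pw)   q<w = <-asym q<w (below _ pw)

      ¬below : ∀ {q p w} → (∀ w → Comp (par T) q p w → q < w) → w ≡ q ⊎ Comp (par T) q p w → ¬ w < q
      ¬below above (inj₁ refl) q<q = <-irrefl refl q<q
      ¬below above (inj₂ pw)   w<q = <-asym w<q (above _ pw)

    two-predecessors-clash : ∀ {q p r} → Q p q → Q r q → p ≢ r →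
      x ≡ q ⊎ Comp (par T) q p x → y ≡ q ⊎ Comp (par T) q p y → Comp (par T) q r j → ⊥
    two-predecessors-clash {q} {p} {r} pq rq p≢r x∈ y∈ rj with twoSlots q | slots q
    ... | false | unique = p≢r (unique p r pq rq)
    ... | true | sides , uniqueˡ , uniqueʳ with sides p pq | sides r rq
    ...   | inj₁ below-p | inj₁ below-r = p≢r (uniqueˡ p r pq rq (below-p p ε) (below-r r ε))
    ...   | inj₂ above-p | inj₂ above-r = p≢r (uniqueʳ p r pq rq (above-p p ε) (above-r r ε))
    ...   | inj₁ below-p | inj₂ above-r =
      [ ¬above below-p x∈ , ¬above below-p y∈ ]′ (between⇒one-above (above-r j rj) j-between)
    ...   | inj₂ above-p | inj₁ below-r =
      [ ¬below above-p x∈ , ¬below above-p y∈ ]′ (between⇒one-below (below-r j rj) j-between)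

    climb-from : ∀ q p (visited rest : List (Fin n)) →
      Linked _—_ (q ∷ p ∷ visited) → Unique (q ∷ p ∷ visited) →
      x ∈ q ∷ p ∷ visited → y ∈ q ∷ p ∷ visited → Q p q → Star Q y q →
      Linked _—_ (q ∷ rest) → Unique rest → q ∉ rest → (∀ {z} → z ∈ rest → z ∉ q ∷ p ∷ visited) →
      lastOf q rest ≡ j → Star Q y j
    climb-from q p visited [] _ _ _ _ _ yq _ _ _ _ refl = yq
    climb-from q p visited (r ∷ rest) (qp ∷ Lv) (q∉ ∷ Uv) x∈ y∈ pq yq
               (qr ∷ Lr) (r∉ ∷ Ur) q∉r disj last≡
      with —⇒Q qr
    ... | inj₁ Qqr =
      climb-from r q (p ∷ visited) rest (Adj-sym (par T) qr ∷ qp ∷ Lv)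
        (¬Any⇒All¬ _ (disj (here refl)) ∷ q∉ ∷ Uv) (there x∈) (there y∈) Qqr (yq ◅◅ Qqr ◅ ε)
        Lr Ur (All¬⇒¬Any r∉) (λ z∈ → ∉-∷ (λ z≡r → lookup r∉ z∈ (sym z≡r)) (disj (there z∈)))
        last≡
      where
        ∉-∷ : ∀ {z} {zs : List (Fin n)} → z ≢ r → z ∉ zs → z ∉ r ∷ zs
        ∉-∷ z≢r _   (here z≡r) = z≢r z≡r
        ∉-∷ _   z∉ (there z∈)  = z∉ z∈
    ... | inj₂ Qrq =
      ⊥-elim (two-predecessors-clash pq Qrq (λ p≡r → disj (here refl) (there (here (sym p≡r))))
                (near x∈) (near y∈) (subst (Comp (par T) q r) last≡ rj))
      where
        near : ∀ {w} → w ∈ q ∷ p ∷ visited → w ≡ q ⊎ Comp (par T) q p w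
        near (here w≡q) = inj₁ w≡q
        near (there w∈) = inj₂ (Linked⇒Comp (par T) Lv q∉ w∈)

        rj : Comp (par T) q r (lastOf r rest)
        rj = Linked⇒Comp (par T) Lr (¬Any⇒All¬ _ q∉r) (lastOf-∈ r rest)

    -- The simple path y ⋯ j can never step against Q: the first such step gives its vertex two
    -- Q-predecessors, one on the side of x and y and one on the side of j.
    climb : (zs : List (Fin n)) → Linked _—_ (y ∷ zs) → Unique (y ∷ zs) → lastOf y zs ≡ j →
      x ∉ y ∷ zs → Q x y → Star Q y j
    climb zs L (y∉ ∷ U) last≡ x∉ xy =
      climb-from y x [] zs (Adj-sym (par T) (Q⇒— xy) ∷ [-])
        (((λ y≡x → x∉ (here (sym y≡x))) ∷ []) ∷ [] ∷ [])
        (there (here refl)) (here refl) xy ε L U (All¬⇒¬Any y∉) disj last≡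
      where
        disj : ∀ {z} → z ∈ zs → z ∉ y ∷ x ∷ []
        disj z∈ (here z≡y)         = lookup y∉ z∈ (sym z≡y)
        disj z∈ (there (here z≡x)) = x∉ (there (subst (_∈ zs) z≡x z∈))

  edge-between : ∀ {x y j} → x ⟶ y → Between j x y → Star _⟶_ j x ⊎ Star _⟶_ y j
  edge-between {x} {y} {j} xy bt with Star⇒SimplePath _≟_ (connected y j)
  ... | zs , L , U@(y∉ ∷ _) , last≡ with x ∈? y ∷ zs
  ...   | no x∉ =
    inj₂ (Climb.climb _⟶_ inj₁ id (twoDown ∘′ δ) (children T) bt zs L U last≡ x∉ xy)
  ...   | yes (here refl) = ⊥-elim (irreflexive x xy)
  ...   | yes (there x∈) =
    inj₁ (Star.reverse id
      (Climb.climb (flip _⟶_) inj₂ Data.Sum.swap (twoUp ∘′ δ) (parents T) (between-sym bt)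
         (suffixFrom x∈) (Linked-suffixFrom x∈ (Linked.tail L)) (Unique-suffixFrom x∈ (AllPairs.tail U))
         (trans (lastOf-suffixFrom y x∈) last≡) (All¬⇒¬Any (All-suffixFrom x∈ y∉)) xy))

  down-vertex-not-jumped : ∀ {j u v} → twoDown (δ j) ≡ true → u ⟶ v → Between j u v → ¬ Star _⟶_ v j
  down-vertex-not-jumped {j} two uv bt vj
    with descendant∈child-component (par T) vj (between⇒≢ʳ bt ∘′ sym)
       | subst (λ b → SlotOK (par T) b j (λ c → c ⟶ j)) two (children T j)
  ... | c , cj , cv | sides , _ =
    OneSided-¬between (par T) (sides c cj) bt
      (cv ◅◅ (inj₂ uv , between⇒≢ʳ bt ∘′ sym , between⇒≢ˡ bt ∘′ sym) ◅ ε) cv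

  up-vertex-not-jumped : ∀ {j u v} → twoUp (δ j) ≡ true → u ⟶ v → Between j u v → ¬ Star _⟶_ j u
  up-vertex-not-jumped {j} two uv bt ju
    with ancestor∈parent-component (par T) ju (between⇒≢ˡ bt ∘′ sym)
       | subst (λ b → SlotOK (par T) b j (λ p → j ⟶ p)) two (parents T j)
  ... | p , jp , pu | sides , _ =
    OneSided-¬between (par T) (sides p jp) bt
      pu (pu ◅◅ (inj₁ uv , between⇒≢ˡ bt ∘′ sym , between⇒≢ʳ bt ∘′ sym) ◅ ε)

  conditions : Conditions δ (InvSet T)
  conditions i j k i<j j<k = transitive , cotransitive , down-condition , up-condition
    where
      k>j>i : Between j k i
      k>j>i = inj₂ (i<j , j<k)

      transitive : InvSet T i j → InvSet T j k → InvSet T i k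
      transitive (_ , ji) (_ , kj) = <-trans i<j j<k , kj ◅◅ ji

      cotransitive : ¬ InvSet T i j → ¬ InvSet T j k → ¬ InvSet T i k
      cotransitive ¬ij ¬jk (_ , ki) with Star-between ki k>j>i
      ... | inj₁ (_ , ji) = ¬ij (i<j , ji)
      ... | inj₂ (u , v , ku , uv , vi , bt) with edge-between uv bt
      ...   | inj₁ ju = ¬ij (i<j , ju ◅◅ uv ◅ vi)
      ...   | inj₂ vj = ¬jk (j<k , ku ◅◅ uv ◅ vj)

      down-condition : (δ j ≡ down ⊎ δ j ≡ updown) → ¬ InvSet T i j → InvSet T j k → ¬ InvSet T i k
      down-condition two-down ¬ij _ (_ , ki) with Star-between ki k>j>i
      ... | inj₁ (_ , ji) = ¬ij (i<j , ji)
      ... | inj₂ (u , v , ku , uv , vi , bt) with edge-between uv bt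
      ...   | inj₁ ju = ¬ij (i<j , ju ◅◅ uv ◅ vi)
      ...   | inj₂ vj = down-vertex-not-jumped (down⊎updown⇒twoDown two-down) uv bt vj

      up-condition : (δ j ≡ up ⊎ δ j ≡ updown) → InvSet T i j → ¬ InvSet T j k → ¬ InvSet T i k
      up-condition two-up _ ¬jk (_ , ki) with Star-between ki k>j>i
      ... | inj₁ (kj , _) = ¬jk (j<k , kj)
      ... | inj₂ (u , v , ku , uv , vi , bt) with edge-between uv bt
      ...   | inj₁ ju = up-vertex-not-jumped (up⊎updown⇒twoUp two-up) uv bt ju
      ...   | inj₂ vj = ¬jk (j<k , ku ◅◅ uv ◅ vj)

module PermutreeFromConditions {n : ℕ} (δ : Fin n → Dec4) (E : Fin n → Fin n → Bool)
                               (cond : Conditions δ (λ i j → E i j ≡ true)) where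

  Inv NotInv : Fin n → Fin n → Set
  Inv i j = E i j ≡ true
  NotInv i j = E i j ≡ false

  Down Up : Fin n → Set
  Down k = twoDown (δ k) ≡ true
  Up k = twoUp (δ k) ≡ true

  inv-noninv : ∀ {i j} → Inv i j → NotInv i j → ⊥
  inv-noninv = Bool.not-¬

  inv⊎noninv : ∀ i j → Inv i j ⊎ NotInv i j
  inv⊎noninv i j with E i j
  ... | true  = inj₁ refl
  ... | false = inj₂ refl

  ¬inv⇒noninv : ∀ {i j} → ¬ Inv i j → NotInv i j
  ¬inv⇒noninv = Bool.¬-not

  module _ {i j k : Fin n} (i<j : i < j) (j<k : j < k) where

    inv-trans : Inv i j → Inv j k → Inv i k
    inv-trans = proj₁ (cond i j k i<j j<k)

    noninv-trans : NotInv i j → NotInv j k → NotInv i k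
    noninv-trans ij jk =
      ¬inv⇒noninv (proj₁ (proj₂ (cond i j k i<j j<k)) (λ e → inv-noninv e ij) (λ e → inv-noninv e jk))

    down-rule : Down j → NotInv i j → Inv j k → NotInv i k
    down-rule dj ij jk =
      ¬inv⇒noninv (proj₁ (proj₂ (proj₂ (cond i j k i<j j<k)))
        (twoDown⇒down⊎updown dj) (λ e → inv-noninv e ij) jk)

    up-rule : Up j → Inv i j → NotInv j k → NotInv i k
    up-rule uj ij jk =
      ¬inv⇒noninv (proj₂ (proj₂ (proj₂ (cond i j k i<j j<k)))
        (twoUp⇒up⊎updown uj) ij (λ e → inv-noninv e jk))

  _≺_ : Fin n → Fin n → Set
  a ≺ b = (b < a × Inv b a) ⊎ (a < b × NotInv a b)

  _≺?_ : ∀ a b → Dec (a ≺ b)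
  a ≺? b = ((b <? a) ×-dec (E b a Bool.≟ true)) ⊎-dec ((a <? b) ×-dec (E a b Bool.≟ false))

  ≺⇒inv : ∀ {i j} → i < j → j ≺ i → Inv i j
  ≺⇒inv _   (inj₁ (_ , ij))   = ij
  ≺⇒inv i<j (inj₂ (j<i , _)) = ⊥-elim (<-asym i<j j<i)

  ≺⇒noninv : ∀ {i j} → i < j → i ≺ j → NotInv i j
  ≺⇒noninv i<j (inj₁ (j<i , _)) = ⊥-elim (<-asym i<j j<i)
  ≺⇒noninv _   (inj₂ (_ , ij))   = ij

  ≺-irrefl : ∀ {a} → ¬ a ≺ a
  ≺-irrefl (inj₁ (a<a , _)) = <-irrefl refl a<a
  ≺-irrefl (inj₂ (a<a , _)) = <-irrefl refl a<a

  ≺⇒≢ : ∀ {a b} → a ≺ b → a ≢ b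
  ≺⇒≢ a≺a refl = ≺-irrefl a≺a

  ≺-asym : ∀ {a b} → a ≺ b → ¬ b ≺ a
  ≺-asym (inj₁ (b<a , _))  (inj₁ (a<b , _))  = <-asym a<b b<a
  ≺-asym (inj₁ (_ , ba))   (inj₂ (_ , ba′))  = inv-noninv ba ba′
  ≺-asym (inj₂ (_ , ab))   (inj₁ (_ , ab′))  = inv-noninv ab′ ab
  ≺-asym (inj₂ (a<b , _))  (inj₂ (b<a , _))  = <-asym a<b b<a

  ≺-total : ∀ {a b} → a ≢ b → a ≺ b ⊎ b ≺ a
  ≺-total {a} {b} a≢b with ≢⇒<⊎> a≢b
  ... | inj₁ a<b with inv⊎noninv a b
  ...   | inj₁ ab = inj₂ (inj₁ (a<b , ab))
  ...   | inj₂ ab = inj₁ (inj₂ (a<b , ab))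
  ≺-total {a} {b} a≢b | inj₂ b<a with inv⊎noninv b a
  ...   | inj₁ ba = inj₁ (inj₁ (b<a , ba))
  ...   | inj₂ ba = inj₂ (inj₂ (b<a , ba))

  ≺-by-contra : ∀ {a b} → a ≢ b → ¬ b ≺ a → a ≺ b
  ≺-by-contra a≢b ¬b≺a with ≺-total a≢b
  ... | inj₁ a≺b = a≺b
  ... | inj₂ b≺a = ⊥-elim (¬b≺a b≺a)

  ≺-trans : ∀ {a b c} → a ≺ b → b ≺ c → a ≺ c
  ≺-trans (inj₁ (b<a , ba)) (inj₁ (c<b , cb)) = inj₁ (<-trans c<b b<a , inv-trans c<b b<a cb ba)
  ≺-trans (inj₂ (a<b , ab)) (inj₂ (b<c , bc)) = inj₂ (<-trans a<b b<c , noninv-trans a<b b<c ab bc)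
  ≺-trans (inj₁ (b<a , ba)) (inj₂ (b<c , bc)) = ≺-by-contra (λ { refl → inv-noninv ba bc })
    λ { (inj₁ (a<c , ac)) → inv-noninv (inv-trans b<a a<c ba ac) bc
      ; (inj₂ (c<a , ca)) → inv-noninv ba (noninv-trans b<c c<a bc ca) }
  ≺-trans (inj₂ (a<b , ab)) (inj₁ (c<b , cb)) = ≺-by-contra (λ { refl → inv-noninv cb ab })
    λ { (inj₁ (a<c , ac)) → inv-noninv (inv-trans a<c c<b ac cb) ab
      ; (inj₂ (c<a , ca)) → inv-noninv cb (noninv-trans c<a a<b ca ab) }

  Down? : ∀ k → Dec (Down k)
  Down? k = twoDown (δ k) Bool.≟ true

  Up? : ∀ k → Dec (Up k)
  Up? k = twoUp (δ k) Bool.≟ true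

  Clear : Fin n → Fin n → Set
  Clear a b = ∀ k → a < k → k < b →
    (Down k → k ≺ b) × (Up k → a ≺ k) × (∀ k′ → k < k′ → k′ < b → Down k → Up k′ → k ≺ k′)

  Clear? : ∀ a b → Dec (Clear a b)
  Clear? a b = all? λ k → (a <? k) →-dec ((k <? b) →-dec
    ((Down? k →-dec (k ≺? b)) ×-dec (Up? k →-dec (a ≺? k)) ×-dec
     all? (λ k′ → (k <? k′) →-dec ((k′ <? b) →-dec (Down? k →-dec (Up? k′ →-dec (k ≺? k′)))))))

  mkClear : ∀ {a b} →
    (∀ {k} → a < k → k < b → Down k → k ≺ b) → (∀ {k} → a < k → k < b → Up k → a ≺ k) →
    (∀ {k k′} → a < k → k < k′ → k′ < b → Down k → Up k′ → k ≺ k′) → Clear a b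
  mkClear down-ok up-ok pair-ok k a<k k<b =
    down-ok a<k k<b , up-ok a<k k<b , λ k′ k<k′ k′<b → pair-ok a<k k<k′ k′<b

  module _ {a b : Fin n} (clear : Clear a b) where

    clear-down : ∀ {k} → a < k → k < b → Down k → k ≺ b
    clear-down a<k k<b = proj₁ (clear _ a<k k<b)

    clear-up : ∀ {k} → a < k → k < b → Up k → a ≺ k
    clear-up a<k k<b = proj₁ (proj₂ (clear _ a<k k<b))

    clear-pair : ∀ {k k′} → a < k → k < k′ → k′ < b → Down k → Up k′ → k ≺ k′
    clear-pair a<k k<k′ k′<b = proj₂ (proj₂ (clear _ a<k (<-trans k<k′ k′<b))) _ k<k′ k′<b

  _↝_ : Fin n → Fin n → Set
  a ↝ b = (b < a × Inv b a) ⊎ (a < b × NotInv a b × Clear a b)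

  _↝?_ : ∀ a b → Dec (a ↝ b)
  a ↝? b = ((b <? a) ×-dec (E b a Bool.≟ true)) ⊎-dec ((a <? b) ×-dec (E a b Bool.≟ false) ×-dec Clear? a b)

  ↝⇒≺ : ∀ {a b} → a ↝ b → a ≺ b
  ↝⇒≺ (inj₁ b>a)             = inj₁ b>a
  ↝⇒≺ (inj₂ (a<b , ab , _)) = inj₂ (a<b , ab)

  _⋖_ : Fin n → Fin n → Set
  a ⋖ b = a ↝ b × (∀ c → ¬ (a ↝ c × c ↝ b))

  _⋖?_ : ∀ a b → Dec (a ⋖ b)
  a ⋖? b = (a ↝? b) ×-dec all? (λ c → ¬? ((a ↝? c) ×-dec (c ↝? b)))

  ↝-down-between : ∀ {a b k} → a ↝ b → Between k a b → Down k → k ≺ b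
  ↝-down-between (inj₂ (_ , _ , clear)) (inj₁ (a<k , k<b)) = clear-down clear a<k k<b
  ↝-down-between (inj₂ (a<b , _))       (inj₂ (b<k , k<a)) = ⊥-elim (<-asym a<b (<-trans b<k k<a))
  ↝-down-between (inj₁ (b<a , _))       (inj₁ (a<k , k<b)) = ⊥-elim (<-asym b<a (<-trans a<k k<b))
  ↝-down-between {a} {b} {k} (inj₁ (b<a , ba)) (inj₂ (b<k , k<a)) dk with inv⊎noninv b k
  ... | inj₁ bk = inj₁ (b<k , bk)
  ... | inj₂ bk =
    ⊥-elim (inv-noninv ba (down-rule b<k k<a dk bk (≺⇒inv k<a (≺-trans (inj₁ (b<a , ba)) (inj₂ (b<k , bk))))))

  ↝-up-between : ∀ {a b k} → a ↝ b → Between k a b → Up k → a ≺ k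
  ↝-up-between (inj₂ (_ , _ , clear)) (inj₁ (a<k , k<b)) = clear-up clear a<k k<b
  ↝-up-between (inj₂ (a<b , _))       (inj₂ (b<k , k<a)) = ⊥-elim (<-asym a<b (<-trans b<k k<a))
  ↝-up-between (inj₁ (b<a , _))       (inj₁ (a<k , k<b)) = ⊥-elim (<-asym b<a (<-trans a<k k<b))
  ↝-up-between {a} {b} {k} (inj₁ (b<a , ba)) (inj₂ (b<k , k<a)) uk with inv⊎noninv k a
  ... | inj₁ ka = inj₁ (k<a , ka)
  ... | inj₂ ka =
    ⊥-elim (inv-noninv ba (up-rule b<k k<a uk (≺⇒inv b<k (≺-trans (inj₂ (k<a , ka)) (inj₁ (b<a , ba)))) ka))

  Clear-restrictʳ : ∀ {a b k} → Clear a b → k < b → Up k → Clear a k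
  Clear-restrictʳ clear k<b uk = mkClear
    (λ a<j j<k dj → clear-pair clear a<j j<k k<b dj uk)
    (λ a<j j<k → clear-up clear a<j (<-trans j<k k<b))
    (λ a<j j<j′ j′<k → clear-pair clear a<j j<j′ (<-trans j′<k k<b))

  module Interpolate {a b : Fin n} (clear : Clear a b) where

    Inside : Fin n → Set
    Inside x = a < x × x < b × a ≺ x × x ≺ b

    Inside? : ∀ x → Dec (Inside x)
    Inside? x = (a <? x) ×-dec (x <? b) ×-dec (a ≺? x) ×-dec (x ≺? b)

    ≺-greatest-inside⇒↝ : ∀ {m} → Inside m → (∀ {y} → Inside y → y ≡ m ⊎ y ≺ m) → a ↝ m
    ≺-greatest-inside⇒↝ {m} (a<m , m<b , a≺m , _) greatest =
      inj₂ (a<m , ≺⇒noninv a<m a≺m , mkClear down-ok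
        (λ a<k k<m → clear-up clear a<k (<-trans k<m m<b))
        (λ a<k k<k′ k′<m → clear-pair clear a<k k<k′ (<-trans k′<m m<b)))
      where
        down-ok : ∀ {k} → a < k → k < m → Down k → k ≺ m
        down-ok {k} a<k k<m dk = ≺-by-contra (<⇒≢ k<m) λ m≺k →
          let k<b = <-trans k<m m<b in
          [ <⇒≢ k<m , ≺-asym m≺k ]′ (greatest (a<k , k<b , ≺-trans a≺m m≺k , clear-down clear a<k k<b dk))

    <-greatest-descendant⇒↝ : ∀ {m} → Inside m →
      (∀ {y} → Inside y × a ↝ y → y ≡ m ⊎ y < m) → m ↝ b
    <-greatest-descendant⇒↝ {m} (a<m , m<b , _ , m≺b) greatest =
      inj₂ (m<b , ≺⇒noninv m<b m≺b , mkClear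
        (λ m<k → clear-down clear (<-trans a<m m<k))
        up-ok
        (λ m<k → clear-pair clear (<-trans a<m m<k)))
      where
        up-ok : ∀ {k} → m < k → k < b → Up k → m ≺ k
        up-ok {k} m<k k<b uk = ≺-by-contra (<⇒≢ m<k) λ k≺m →
          let a<k = <-trans a<m m<k
              a≺k = clear-up clear a<k k<b uk in
          [ (λ k≡m → <⇒≢ m<k (sym k≡m)) , <-asym m<k ]′
            (greatest ((a<k , k<b , a≺k , ≺-trans k≺m m≺b) ,
                       inj₂ (a<k , ≺⇒noninv a<k a≺k , Clear-restrictʳ clear k<b uk)))

    interpolate : ∀ {j} → Inside j → ∃ λ c → a ↝ c × c ↝ b
    interpolate inside-j with maximal ≺-trans ≺-total Inside? inside-j
    ... | j₁ , inside-j₁ , ≺-greatest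
      with maximal <-trans ≢⇒<⊎> (λ x → Inside? x ×-dec (a ↝? x))
             (inside-j₁ , ≺-greatest-inside⇒↝ inside-j₁ ≺-greatest)
    ...   | j₂ , (inside-j₂ , a↝j₂) , <-greatest =
      j₂ , a↝j₂ , <-greatest-descendant⇒↝ inside-j₂ <-greatest

  ⋖-no-interleaving : ∀ {a b j} → a ⋖ b → Between j a b → a ≺ j → j ≺ b → ⊥
  ⋖-no-interleaving (_ , no-c) (inj₂ (b<j , j<a)) a≺j j≺b =
    no-c _ (inj₁ (j<a , ≺⇒inv j<a a≺j) , inj₁ (b<j , ≺⇒inv b<j j≺b))
  ⋖-no-interleaving (inj₁ (b<a , _) , _) (inj₁ (a<j , j<b)) _ _ = <-asym b<a (<-trans a<j j<b)
  ⋖-no-interleaving (inj₂ (_ , _ , clear) , no-c) (inj₁ (a<j , j<b)) a≺j j≺b =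
    no-c _ (proj₂ (Interpolate.interpolate clear (a<j , j<b , a≺j , j≺b)))

  module _ {a b j : Fin n} (cover : a ⋖ b) (b<j : b < j) (j<a : j < a) where

    private
      a↝b : a ↝ b
      a↝b = proj₁ cover

      inside : ∀ {k} → b < k → k < a → Between k a b
      inside b<k k<a = inj₂ (b<k , k<a)

    ⋖-clear-below : j ≺ a → Clear j a
    ⋖-clear-below j≺a = mkClear down-ok
      (λ j<k k<a uk → ≺-trans j≺a (↝-up-between a↝b (inside (<-trans b<j j<k) k<a) uk))
      (λ j<k k<k′ k′<a dk uk′ → ≺-by-contra (<⇒≢ k<k′) λ k′≺k →
        ≺-asym (≺-trans k′≺k (down-ok j<k (<-trans k<k′ k′<a) dk))
               (↝-up-between a↝b (inside (<-trans (<-trans b<j j<k) k<k′) k′<a) uk′))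
      where
        down-ok : ∀ {k} → j < k → k < a → Down k → k ≺ a
        down-ok j<k k<a dk = ≺-by-contra (<⇒≢ k<a) λ a≺k →
          let bt = inside (<-trans b<j j<k) k<a in
          ⋖-no-interleaving cover bt a≺k (↝-down-between a↝b bt dk)

    ⋖-clear-above : b ≺ j → Clear b j
    ⋖-clear-above b≺j = mkClear
      (λ b<k k<j dk → ≺-trans (↝-down-between a↝b (inside b<k (<-trans k<j j<a)) dk) b≺j)
      up-ok
      (λ b<k k<k′ k′<j dk uk′ → ≺-by-contra (<⇒≢ k<k′) λ k′≺k →
        ≺-asym (≺-trans (↝-down-between a↝b (inside b<k (<-trans (<-trans k<k′ k′<j) j<a)) dk)
                        (up-ok (<-trans b<k k<k′) k′<j uk′)) k′≺k)
      where
        up-ok : ∀ {k} → b < k → k < j → Up k → b ≺ k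
        up-ok b<k k<j uk = ≺-by-contra (<⇒≢ b<k) λ k≺b →
          let bt = inside b<k (<-trans k<j j<a) in
          ⋖-no-interleaving cover bt (↝-up-between a↝b bt uk) k≺b

  ⋖-between : ∀ {a b j} → a ⋖ b → Between j a b → j ↝ a ⊎ b ↝ j
  ⋖-between {a} {b} {j} cover bt with ≺-total (between⇒≢ˡ bt)
  ... | inj₁ j≺a with ≢⇒<⊎> (between⇒≢ˡ bt ∘′ sym)
  ...   | inj₁ a<j = inj₁ (inj₁ (a<j , ≺⇒inv a<j j≺a))
  ...   | inj₂ j<a =
    inj₁ (inj₂ (j<a , ≺⇒noninv j<a j≺a , ⋖-clear-below cover (between-left bt j<a) j<a j≺a))
  ⋖-between {a} {b} {j} cover bt | inj₂ a≺j with ≺-total (between⇒≢ʳ bt)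
  ...   | inj₁ j≺b = ⊥-elim (⋖-no-interleaving cover bt a≺j j≺b)
  ...   | inj₂ b≺j with ≢⇒<⊎> (between⇒≢ʳ bt)
  ...     | inj₁ j<b = inj₂ (inj₁ (j<b , ≺⇒inv j<b b≺j))
  ...     | inj₂ b<j =
    inj₂ (inj₂ (b<j , ≺⇒noninv b<j b≺j , ⋖-clear-above cover b<j (between-right bt b<j) b≺j))

  ≺⇒↝ : ∀ {a b} → b < a → a ≺ b → a ↝ b
  ≺⇒↝ b<a a≺b = inj₁ (b<a , ≺⇒inv b<a a≺b)

  ordered-children-↝ : ∀ {c₁ c₂ i} → c₁ ⋖ i → c₂ ⋖ i → c₁ ≺ c₂ →
    ¬ (Down i × Between i c₁ c₂) → c₁ ↝ c₂
  ordered-children-↝ {c₁} {c₂} {i} cover₁ cover₂ c₁≺c₂ ¬split with ≢⇒<⊎> (≺⇒≢ c₁≺c₂)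
  ... | inj₂ c₂<c₁ = ≺⇒↝ c₂<c₁ c₁≺c₂
  ... | inj₁ c₁<c₂ = inj₂ (c₁<c₂ , ≺⇒noninv c₁<c₂ c₁≺c₂ , mkClear down-ok up-ok pair-ok)
    where
      c₁↝i : c₁ ↝ i
      c₁↝i = proj₁ cover₁

      c₂↝i : c₂ ↝ i
      c₂↝i = proj₁ cover₂

      down-ok : ∀ {k} → c₁ < k → k < c₂ → Down k → k ≺ c₂
      down-ok {k} c₁<k k<c₂ dk = ≺-by-contra (<⇒≢ k<c₂) λ c₂≺k → case k ≟ i of λ where
        (yes refl) → ¬split (dk , inj₁ (c₁<k , k<c₂))
        (no k≢i) → case between-split c₁<k k<c₂ k≢i of λ where
          (inj₁ bt) → ⋖-no-interleaving cover₁ bt (≺-trans c₁≺c₂ c₂≺k) (↝-down-between c₁↝i bt dk)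
          (inj₂ bt) → ⋖-no-interleaving cover₂ bt c₂≺k (↝-down-between c₂↝i bt dk)

      up-ok : ∀ {k} → c₁ < k → k < c₂ → Up k → c₁ ≺ k
      up-ok {k} c₁<k k<c₂ uk = ≺-by-contra (<⇒≢ c₁<k) λ k≺c₁ → case k ≟ i of λ where
        (yes refl) → ≺-asym k≺c₁ (↝⇒≺ c₁↝i)
        (no k≢i) → case between-split c₁<k k<c₂ k≢i of λ where
          (inj₁ bt) → ≺-asym k≺c₁ (↝-up-between c₁↝i bt uk)
          (inj₂ bt) → ≺-asym (≺-trans k≺c₁ c₁≺c₂) (↝-up-between c₂↝i bt uk)

      pair-ok : ∀ {k k′} → c₁ < k → k < k′ → k′ < c₂ → Down k → Up k′ → k ≺ k′
      pair-ok {k} {k′} c₁<k k<k′ k′<c₂ dk uk′ = ≺-by-contra (<⇒≢ k<k′) λ k′≺k →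
        let k≺c₂ = down-ok c₁<k (<-trans k<k′ k′<c₂) dk
            k′≺c₂ = ≺-trans k′≺k k≺c₂ in
        case ((k ≟ i) , (k′ ≟ i)) of λ where
          (yes refl , _) → ¬split (dk , inj₁ (c₁<k , <-trans k<k′ k′<c₂))
          (no _ , yes refl) → ≺-asym k′≺c₂ (↝⇒≺ c₂↝i)
          (no k≢i , no k′≢i) → case (≢⇒<⊎> k≢i , ≢⇒<⊎> k′≢i) of λ where
            (inj₂ i<k , _) →
              let i<k′ = <-trans i<k k<k′ in
              inv-noninv (≺⇒inv (<-trans i<k′ k′<c₂) (↝⇒≺ c₂↝i))
                (up-rule i<k′ k′<c₂ uk′ (≺⇒inv i<k′ (≺-trans k′≺c₂ (↝⇒≺ c₂↝i)))
                  (≺⇒noninv k′<c₂ k′≺c₂))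
            (inj₁ k<i , inj₂ i<k′) →
              ≺-asym k′≺c₂ (↝-up-between c₂↝i (inj₂ (i<k′ , k′<c₂)) uk′)
            (inj₁ k<i , inj₁ k′<i) → case c₁↝i of λ where
              (inj₁ (i<c₁ , _)) → <-asym i<c₁ (<-trans c₁<k k<i)
              (inj₂ (_ , _ , clear)) → ≺-asym k′≺k (clear-pair clear c₁<k k<k′ k′<i dk uk′)

  two-children : ∀ {c₁ c₂ i} → c₁ ⋖ i → c₂ ⋖ i → c₁ ≢ c₂ → Down i × Between i c₁ c₂
  two-children {c₁} {c₂} {i} cover₁ cover₂ c₁≢c₂ with Down? i ×-dec between? i c₁ c₂
  ... | yes split = split
  ... | no ¬split with ≺-total c₁≢c₂
  ...   | inj₁ c₁≺c₂ =
    ⊥-elim (proj₂ cover₁ c₂ (ordered-children-↝ cover₁ cover₂ c₁≺c₂ ¬split , proj₁ cover₂))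
  ...   | inj₂ c₂≺c₁ =
    ⊥-elim (proj₂ cover₂ c₁ (ordered-children-↝ cover₂ cover₁ c₂≺c₁
                               (λ (di , bt) → ¬split (di , between-sym bt)) , proj₁ cover₁))

  ordered-parents-↝ : ∀ {p₁ p₂ i} → i ⋖ p₁ → i ⋖ p₂ → p₁ ≺ p₂ →
    ¬ (Up i × Between i p₁ p₂) → p₁ ↝ p₂
  ordered-parents-↝ {p₁} {p₂} {i} cover₁ cover₂ p₁≺p₂ ¬split with ≢⇒<⊎> (≺⇒≢ p₁≺p₂)
  ... | inj₂ p₂<p₁ = ≺⇒↝ p₂<p₁ p₁≺p₂
  ... | inj₁ p₁<p₂ = inj₂ (p₁<p₂ , ≺⇒noninv p₁<p₂ p₁≺p₂ , mkClear down-ok up-ok pair-ok)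
    where
      i↝p₁ : i ↝ p₁
      i↝p₁ = proj₁ cover₁

      i↝p₂ : i ↝ p₂
      i↝p₂ = proj₁ cover₂

      down-ok : ∀ {k} → p₁ < k → k < p₂ → Down k → k ≺ p₂
      down-ok {k} p₁<k k<p₂ dk = ≺-by-contra (<⇒≢ k<p₂) λ p₂≺k → case k ≟ i of λ where
        (yes refl) → ≺-asym p₂≺k (≺-trans (↝⇒≺ i↝p₁) p₁≺p₂)
        (no k≢i) → case between-split p₁<k k<p₂ k≢i of λ where
          (inj₁ bt) → ≺-asym p₂≺k (≺-trans (↝-down-between i↝p₁ (between-sym bt) dk) p₁≺p₂)
          (inj₂ bt) → ≺-asym p₂≺k (↝-down-between i↝p₂ (between-sym bt) dk)

      up-ok : ∀ {k} → p₁ < k → k < p₂ → Up k → p₁ ≺ k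
      up-ok {k} p₁<k k<p₂ uk = ≺-by-contra (<⇒≢ p₁<k) λ k≺p₁ → case k ≟ i of λ where
        (yes refl) → ¬split (uk , inj₁ (p₁<k , k<p₂))
        (no k≢i) → case between-split p₁<k k<p₂ k≢i of λ where
          (inj₁ bt) →
            ⋖-no-interleaving cover₁ (between-sym bt) (↝-up-between i↝p₁ (between-sym bt) uk) k≺p₁
          (inj₂ bt) → ⋖-no-interleaving cover₂ (between-sym bt) (↝-up-between i↝p₂ (between-sym bt) uk)
                        (≺-trans k≺p₁ p₁≺p₂)

      pair-ok : ∀ {k k′} → p₁ < k → k < k′ → k′ < p₂ → Down k → Up k′ → k ≺ k′
      pair-ok {k} {k′} p₁<k k<k′ k′<p₂ dk uk′ = ≺-by-contra (<⇒≢ k<k′) λ k′≺k →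
        let p₁≺k′ = up-ok (<-trans p₁<k k<k′) k′<p₂ uk′ in
        case ((k ≟ i) , (k′ ≟ i)) of λ where
          (yes refl , _) → ≺-asym p₁≺k′ (≺-trans k′≺k (↝⇒≺ i↝p₁))
          (no _ , yes refl) → ¬split (uk′ , inj₁ (<-trans p₁<k k<k′ , k′<p₂))
          (no k≢i , no k′≢i) → case (≢⇒<⊎> k≢i , ≢⇒<⊎> k′≢i) of λ where
            (inj₂ i<k , _) → case i↝p₂ of λ where
              (inj₁ (p₂<i , _)) → <-asym p₂<i (<-trans i<k (<-trans k<k′ k′<p₂))
              (inj₂ (_ , _ , clear)) → ≺-asym k′≺k (clear-pair clear i<k k<k′ k′<p₂ dk uk′)
            (inj₁ k<i , inj₂ i<k′) →
              ≺-asym (↝-down-between i↝p₁ (inj₂ (p₁<k , k<i)) dk) (≺-trans p₁≺k′ k′≺k)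
            (inj₁ k<i , inj₁ k′<i) →
              let p₁<i = <-trans p₁<k k<i
                  i≺p₁ = ↝⇒≺ i↝p₁ in
              inv-noninv (≺⇒inv p₁<i i≺p₁)
                (down-rule p₁<k k<i dk (≺⇒noninv p₁<k (≺-trans p₁≺k′ k′≺k))
                  (≺⇒inv k<i (≺-trans i≺p₁ (≺-trans p₁≺k′ k′≺k))))

  two-parents : ∀ {p₁ p₂ i} → i ⋖ p₁ → i ⋖ p₂ → p₁ ≢ p₂ → Up i × Between i p₁ p₂
  two-parents {p₁} {p₂} {i} cover₁ cover₂ p₁≢p₂ with Up? i ×-dec between? i p₁ p₂
  ... | yes split = split
  ... | no ¬split with ≺-total p₁≢p₂
  ...   | inj₁ p₁≺p₂ =
    ⊥-elim (proj₂ cover₂ p₁ (proj₁ cover₁ , ordered-parents-↝ cover₁ cover₂ p₁≺p₂ ¬split))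
  ...   | inj₂ p₂≺p₁ =
    ⊥-elim (proj₂ cover₁ p₂ (proj₁ cover₂ , ordered-parents-↝ cover₂ cover₁ p₂≺p₁
                                              (λ (ui , bt) → ¬split (ui , between-sym bt))))

  -- opaque, so that the decision procedure for ⋖ is never unfolded during type checking
  opaque
    hasse : Fin n → Fin n → Bool
    hasse a b = isYes (a ⋖? b)

    hasse⇒⋖ : ∀ {a b} → Par hasse a b → a ⋖ b
    hasse⇒⋖ {a} {b} a⟶b with a ⋖? b
    ... | yes a⋖b = a⋖b

    ⋖⇒hasse : ∀ {a b} → a ⋖ b → Par hasse a b
    ⋖⇒hasse {a} {b} a⋖b with a ⋖? b
    ... | yes _   = refl
    ... | no ¬a⋖b = ⊥-elim (¬a⋖b a⋖b)

  _⟶_ _—_ : Fin n → Fin n → Set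
  _⟶_ = Par hasse
  _—_ = Adj hasse

  ⟶⇒≺ : ∀ {a b} → a ⟶ b → a ≺ b
  ⟶⇒≺ = ↝⇒≺ ∘′ proj₁ ∘′ hasse⇒⋖

  ≺-isStrictPartialOrder : IsStrictPartialOrder _≡_ _≺_
  ≺-isStrictPartialOrder = record
    { isEquivalence = ≡.isEquivalence
    ; irrefl        = λ { refl → ≺-irrefl }
    ; trans         = ≺-trans
    ; <-resp-≈      = ≡.resp₂ _≺_
    }

  ↝⇒path : ∀ {a b} → a ↝ b → Star _⟶_ a b
  ↝⇒path {a} {b} = go (spo-wellFounded ≺-isStrictPartialOrder b) (spo-noetherian ≺-isStrictPartialOrder a)
    where
      -- lexicographic recursion: the target descends in ≺, or it stays and the source ascends
      go : ∀ {a b} → Acc _≺_ b → Acc (flip _≺_) a → a ↝ b → Star _⟶_ a b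
      go {a} {b} (acc below-b) (acc above-a) a↝b with a ⋖? b
      ... | yes a⋖b = ⋖⇒hasse a⋖b ◅ ε
      ... | no ¬a⋖b with any? (λ c → (a ↝? c) ×-dec (c ↝? b))
      ...   | yes (c , a↝c , c↝b) =
        go (below-b (↝⇒≺ c↝b)) (acc above-a) a↝c ◅◅ go (acc below-b) (above-a (↝⇒≺ a↝c)) c↝b
      ...   | no ∄c = ⊥-elim (¬a⋖b (a↝b , λ c a↝c↝b → ∄c (c , a↝c↝b)))

  path⇒≼ : ∀ {a b} → Star _⟶_ a b → a ≡ b ⊎ a ≺ b
  path⇒≼ ε = inj₁ refl
  path⇒≼ (a⟶ ◅ path) with path⇒≼ path
  ... | inj₁ refl = inj₂ (⟶⇒≺ a⟶)
  ... | inj₂ ≺b   = inj₂ (≺-trans (⟶⇒≺ a⟶) ≺b)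

  consecutive-↝ : ∀ {a b} → toℕ b ≡ suc (toℕ a) → a ↝ b ⊎ b ↝ a
  consecutive-↝ {a} {b} b≡1+a with inv⊎noninv a b
  ... | inj₁ ab = inj₂ (inj₁ (ℕ.≤-reflexive (sym b≡1+a) , ab))
  ... | inj₂ ab = inj₁ (inj₂ (ℕ.≤-reflexive (sym b≡1+a) , ab , nothing-between))
    where
      nothing-between : Clear a b
      nothing-between k a<k k<b = ⊥-elim (ℕ.<⇒≱ a<k (s≤s⁻¹ (ℕ.≤-trans k<b (ℕ.≤-reflexive b≡1+a))))

  connected : ∀ x y → Star _—_ x y
  connected = consecutive⇒connected (Adj-sym hasse) λ a b b≡1+a → case consecutive-↝ b≡1+a of λ where
    (inj₁ a↝b) → Star.map inj₁ (↝⇒path a↝b)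
    (inj₂ b↝a) → Star.reverse (Adj-sym hasse) (Star.map inj₁ (↝⇒path b↝a))

  edge-not-over-down : ∀ {x y m} → x — y → Between m x y → Down m → x ≺ m → y ≺ m → ⊥
  edge-not-over-down (inj₁ x⟶y) bt dm x≺m y≺m with ⋖-between (hasse⇒⋖ x⟶y) bt
  ... | inj₁ m↝x = ≺-asym x≺m (↝⇒≺ m↝x)
  ... | inj₂ y↝m = ≺-asym y≺m (↝-down-between (proj₁ (hasse⇒⋖ x⟶y)) bt dm)
  edge-not-over-down (inj₂ y⟶x) bt dm x≺m y≺m =
    edge-not-over-down (inj₁ y⟶x) (between-sym bt) dm y≺m x≺m

  no-walk-below-between-children : ∀ {m p q} → p ≢ q → p ⟶ m → q ⟶ m →
    Star (λ u v → u — v × u ≺ m × v ≺ m) p q → ⊥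
  no-walk-below-between-children {m} p≢q p⟶m q⟶m walk
    with two-children (hasse⇒⋖ p⟶m) (hasse⇒⋖ q⟶m) p≢q
  ... | dm , inj₁ (p<m , m<q) with Star-crossing (_<? m) walk p<m (<-asym m<q)
  ...   | x , y , _ , (xy , x≺m , y≺m) , x<m , y≮m =
    edge-not-over-down xy (between-below x<m y≮m (≺⇒≢ y≺m)) dm x≺m y≺m
  no-walk-below-between-children {m} p≢q p⟶m q⟶m walk | dm , inj₂ (q<m , m<p)
    with Star-crossing (m <?_) walk m<p (<-asym q<m)
  ...   | x , y , _ , (xy , x≺m , y≺m) , m<x , m≮y =
    edge-not-over-down xy (between-above m<x m≮y (≺⇒≢ y≺m)) dm x≺m y≺m

  —⇒⟶ : ∀ {w m} → w — m → w ≺ m → w ⟶ m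
  —⇒⟶ (inj₁ w⟶m) _   = w⟶m
  —⇒⟶ (inj₂ m⟶w) w≺m = ⊥-elim (≺-asym w≺m (⟶⇒≺ m⟶w))

  no-cycle-through-maximum : ∀ {m k} (ws : List (Fin n)) → length ws ≡ suc (suc k) →
    Linked _—_ (m ∷ ws ++ m ∷ []) → Unique (m ∷ ws) → All (_≺ m) ws → ⊥
  no-cycle-through-maximum (w ∷ w′ ∷ ws) _ (m—w ∷ L) (_ ∷ (w∉ ∷ _)) below
    with Linked-∷ʳ⁻ (w′ ∷ ws) L
  ... | L′ , last—m =
    no-walk-below-between-children (lookup w∉ (lastOf-∈ w′ ws))
      (—⇒⟶ (Adj-sym hasse m—w) (lookup below (here refl)))
      (—⇒⟶ last—m (lookup below (there (lastOf-∈ w′ ws))))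
      (Linked⇒Star (Linked-restrict L′ below) (lastOf-∈ w (w′ ∷ ws)))

  -- Rotated to start at its ≺-greatest vertex m, a cycle would join two children of m by a walk
  -- below m in ≺ that crosses the label m, which the down vertex m does not allow.
  acyclic : ∀ cs → ¬ IsCycle hasse cs
  acyclic (x ∷ y ∷ z ∷ zs) (U , L) with maximum _≟_ ≺-trans ≺-total x (y ∷ z ∷ zs)
  ... | m , m∈ , below with ∈-∃++ m∈
  ...   | pre , post , cs≡ =
    no-cycle-through-maximum (post ++ pre) (ℕ.suc-injective (sym (↭-length rotation)))
      (Linked-rotate pre post cs≡ L) (Unique-resp-↭ (≡.setoid _) (↭⇒↭ₛ rotation) U) strictly-below
    where
      rotation : x ∷ y ∷ z ∷ zs ↭ m ∷ post ++ pre
      rotation = ↭-trans (↭-reflexive cs≡) (↭-++-comm pre (m ∷ post))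

      strictly-below : All (_≺ m) (post ++ pre)
      strictly-below with All-resp-↭ rotation below | Unique-resp-↭ (≡.setoid _) (↭⇒↭ₛ rotation) U
      ... | _ ∷ ≼m | m∉ ∷ _ =
        All.tabulate λ w∈ → [ (λ w≡m → ⊥-elim (lookup m∉ w∈ (sym w≡m))) , id ]′ (lookup ≼m w∈)

  no-bypass : ∀ {x a b} → a ≢ b → x — a → x — b → ¬ Comp hasse x a b
  no-bypass {x} {a} a≢b x—a x—b a→b with Star⇒SimplePath _≟_ a→b
  ... | [] , _ , _ , a≡b = a≢b a≡b
  ... | z ∷ zs , L , U , last≡b =
    acyclic (x ∷ a ∷ z ∷ zs)
      ( Linked-avoid⇒All≢ hasse L ∷ U
      , x—a ∷ Linked-∷ʳ (z ∷ zs) (Linked.map proj₁ L) (subst (_— x) (sym last≡b) (Adj-sym hasse x—b)))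

  children-OneSided : ∀ {i c} → Down i → c ⟶ i → OneSided hasse i c
  children-OneSided {i} {c} di c⟶i = NoJumpOver⇒OneSided hasse (≺⇒≢ (⟶⇒≺ c⟶i)) no-jump
    where
      no-jump : NoJumpOver hasse i c
      no-jump x⟶y bt c→x c→y with ⋖-between (hasse⇒⋖ x⟶y) bt
      ... | inj₂ y↝i = ≺-asym (↝-down-between (proj₁ (hasse⇒⋖ x⟶y)) bt di) (↝⇒≺ y↝i)
      ... | inj₁ i↝x with ancestor∈parent-component hasse (↝⇒path i↝x) (between⇒≢ˡ bt ∘′ sym)
      ...   | p , i⟶p , p→x =
        no-bypass (λ c≡p → ≺-asym (⟶⇒≺ c⟶i) (subst (i ≺_) (sym c≡p) (⟶⇒≺ i⟶p)))
          (inj₂ c⟶i) (inj₁ i⟶p) (c→x ◅◅ Comp-sym hasse p→x)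

  parents-OneSided : ∀ {i p} → Up i → i ⟶ p → OneSided hasse i p
  parents-OneSided {i} {p} ui i⟶p = NoJumpOver⇒OneSided hasse (≺⇒≢ (⟶⇒≺ i⟶p) ∘′ sym) no-jump
    where
      no-jump : NoJumpOver hasse i p
      no-jump x⟶y bt p→x p→y with ⋖-between (hasse⇒⋖ x⟶y) bt
      ... | inj₁ i↝x = ≺-asym (↝-up-between (proj₁ (hasse⇒⋖ x⟶y)) bt ui) (↝⇒≺ i↝x)
      ... | inj₂ y↝i with descendant∈child-component hasse (↝⇒path y↝i) (between⇒≢ʳ bt ∘′ sym)
      ...   | c , c⟶i , c→y =
        no-bypass (λ p≡c → ≺-asym (⟶⇒≺ c⟶i) (subst (i ≺_) p≡c (⟶⇒≺ i⟶p)))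
          (inj₁ i⟶p) (inj₂ c⟶i) (p→y ◅◅ Comp-sym hasse c→y)

  children-split : ∀ {i c₁ c₂} → c₁ ⟶ i → c₂ ⟶ i → c₁ ≢ c₂ → Down i × Between i c₁ c₂
  children-split c₁⟶i c₂⟶i = two-children (hasse⇒⋖ c₁⟶i) (hasse⇒⋖ c₂⟶i)

  parents-split : ∀ {i p₁ p₂} → i ⟶ p₁ → i ⟶ p₂ → p₁ ≢ p₂ → Up i × Between i p₁ p₂
  parents-split i⟶p₁ i⟶p₂ = two-parents (hasse⇒⋖ i⟶p₁) (hasse⇒⋖ i⟶p₂)

  children-slots : ∀ i → SlotOK hasse (twoDown (δ i)) i (_⟶ i)
  children-slots i with twoDown (δ i) in two
  ... | false = λ c₁ c₂ c₁⟶i c₂⟶i → case c₁ ≟ c₂ of λ where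
    (yes c₁≡c₂) → c₁≡c₂
    (no c₁≢c₂)  → ⊥-elim (Bool.not-¬ (proj₁ (children-split c₁⟶i c₂⟶i c₁≢c₂)) two)
  ... | true =
      (λ _ → children-OneSided two)
    , (λ _ _ c₁⟶i c₂⟶i → between-unique-below (proj₂ ∘′ children-split c₁⟶i c₂⟶i))
    , (λ _ _ c₁⟶i c₂⟶i → between-unique-above (proj₂ ∘′ children-split c₁⟶i c₂⟶i))

  parents-slots : ∀ i → SlotOK hasse (twoUp (δ i)) i (i ⟶_)
  parents-slots i with twoUp (δ i) in two
  ... | false = λ p₁ p₂ i⟶p₁ i⟶p₂ → case p₁ ≟ p₂ of λ where
    (yes p₁≡p₂) → p₁≡p₂
    (no p₁≢p₂)  → ⊥-elim (Bool.not-¬ (proj₁ (parents-split i⟶p₁ i⟶p₂ p₁≢p₂)) two)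
  ... | true =
      (λ _ → parents-OneSided two)
    , (λ _ _ i⟶p₁ i⟶p₂ → between-unique-below (proj₂ ∘′ parents-split i⟶p₁ i⟶p₂))
    , (λ _ _ i⟶p₁ i⟶p₂ → between-unique-above (proj₂ ∘′ parents-split i⟶p₁ i⟶p₂))

  permutree : Permutree n δ
  permutree = record
    { par      = hasse
    ; tree     = (λ x x⟶x → ≺-irrefl (⟶⇒≺ x⟶x))
               , (λ x y (x⟶y , y⟶x) → ≺-asym (⟶⇒≺ x⟶y) (⟶⇒≺ y⟶x))
               , connected
               , acyclic
    ; parents  = parents-slots
    ; children = children-slots
    }

  permutree-inversions : (∀ i j → Inv i j → i < j) → ∀ i j → Inv i j ⇔ InvSet permutree i j
  permutree-inversions inv⇒< i j = mk⇔
    (λ ij → inv⇒< i j ij , ↝⇒path (inj₁ (inv⇒< i j ij , ij)))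
    λ (i<j , j→i) → case path⇒≼ j→i of λ where
      (inj₁ j≡i) → ⊥-elim (<-irrefl (sym j≡i) i<j)
      (inj₂ j≺i) → ≺⇒inv i<j j≺i

lemma3p2 : (n : ℕ) (δ : Fin n → Dec4) → IsDecoration n δ →
    ((T : Permutree n δ) → Conditions δ (InvSet T))
    × ((E : Fin n → Fin n → Bool) →
        (∀ i j → E i j ≡ true → i < j) →
        Conditions δ (λ i j → E i j ≡ true) →
        Σ (Permutree n δ) (λ T → ∀ i j → (E i j ≡ true) ⇔ InvSet T i j))
-- The boundary convention δ₁ = δₙ = none is not needed.
lemma3p2 n δ _ =
    InversionsOfPermutree.conditions
  , λ E inv⇒< cond → let open PermutreeFromConditions δ E cond in permutree , permutree-inversions inv⇒<
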